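{- For any permutation $\pi\in S_n$, $$\left|\mathcal{O}^{ -1}_{\mathrm{MVP}_n}(\pi)\right|=|\mathrm{Valid}(\pi)|\le|\mathrm{Sub}(\pi)|=\prod_{i\in[n]}\bigl(1+|\mathrm{LInv}_\pi(i)|\bigr).$$
   Context: Let $[n]=\{1,\dots,n\}$. A parking preference is $p\in[n]^n$. In the MVP parking process, cars $1,\dots,n$ enter in order a one-way street with spots $1,\dots,n$; car $i$ parks in spot $p_i$, and if $p_i$ was occupied by an earlier car $j$, car $j$ is bumped and parks in the first unoccupied spot $k>p_i$ (bumped cars do not bump others). $p$ is an MVP parking function if all cars park; $\mathrm{MVP}_n$ is the set of these. The outcome $\mathcal{O}_{\mathrm{MVP}_n}(p)$ is the permutation $\pi$ with $\pi_i$ the car in spot $i$ at the end, and $\mathcal{O}^{ -1}_{\mathrm{MVP}_n}(\pi)=\{p\in\mathrm{MVP}_n:\mathcal{O}_{\mathrm{MVP}_n}(p)=\pi\}$. For $\pi\in S_n$: $\mathrm{Inv}(\pi)=\{(j,i):j<i,\ \pi_j>\pi_i\}$; $\mathrm{LInv}_\pi(i)=\{j:(j,i)\in\mathrm{Inv}(\pi)\}$; $\mathrm{Sub}(\pi)$ is the set of $S\subseteq\mathrm{Inv}(\pi)$ such that each $i$ has at most one $j$ with $(j,i)\in S$. For $S\in\mathrm{Sub}(\pi)$, $\Psi_{\mathrm{Sub}\to\mathrm{PF}}(S)$ is the preference $p$ with $p_{\pi_i}=i$ if no $(j,i)\in S$, and $p_{\pi_i}=j$ if $(j,i)\in S$.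 $S$ is valid if $\mathcal{O}_{\mathrm{MVP}_n}(\Psi_{\mathrm{Sub}\to\mathrm{PF}}(S))=\pi$, and $\mathrm{Valid}(\pi)$ is the set of valid $S\in\mathrm{Sub}(\pi)$. -}

module Defs where

open import Data.Nat using (ℕ; zero; suc; _<ᵇ_)
open import Data.Bool using (Bool; true; false; if_then_else_; _∧_)
open import Data.Maybe using (Maybe; just; nothing; is-nothing; _>>=_)
open import Data.Fin using (Fin; toℕ; _≟_)
open import Data.List using (List; []; _∷_; allFin; filterᵇ; length; map; concatMap)
open import Data.Vec using (Vec; []; _∷_; lookup)
open import Data.Fin.Permutation using (Permutation′; _⟨$⟩ʳ_; _⟨$⟩ˡ_)
open import Relation.Nullary.Decidable using (⌊_⌋)

-- All conventions are 0-indexed: cars, spots and positions are elements of Fin n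
-- (car / spot / position  k+1  of the paper is  k : Fin n).

-- A parking preference p ∈ [n]^n: p lookup c is the preferred spot of car c.
Pref : ℕ → Set
Pref n = Vec (Fin n) n

-- Street occupancy: spot ↦ car parked there (if any).
Occ : ℕ → Set
Occ n = Fin n → Maybe (Fin n)

emptyOcc : ∀ {n} → Occ n
emptyOcc _ = nothing

update : ∀ {n} → Occ n → Fin n → Maybe (Fin n) → Occ n
update o s v t = if ⌊ t ≟ s ⌋ then v else o t

firstFreeAfter : ∀ {n} → Occ n → Fin n → Maybe (Fin n)
firstFreeAfter {n} o s = go (allFin n)
  where
  go : List (Fin n) → Maybe (Fin n)
  go [] = nothing
  go (k ∷ ks) = if (toℕ s <ᵇ toℕ k) ∧ is-nothing (o k) then just k else go ks

mvpStep : ∀ {n} → Occ n → Fin n → Fin n → Maybe (Occ n)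
mvpStep o i s with o s
... | nothing = just (update o s (just i))
... | just j with firstFreeAfter o s
...   | nothing = nothing
...   | just k = just (update (update o s (just i)) k (just j))

mvpRun : ∀ {n} → Pref n → List (Fin n) → Occ n → Maybe (Occ n)
mvpRun p [] o = just o
mvpRun p (i ∷ is) o = mvpStep o i (lookup p i) >>= mvpRun p is

mvpFinal : ∀ {n} → Pref n → Maybe (Occ n)
mvpFinal {n} p = mvpRun p (allFin n) emptyOcc

isMVP : ∀ {n} → Pref n → Bool
isMVP p with mvpFinal p
... | nothing = false
... | just _ = true

allᵇ : ∀ {A : Set} → (A → Bool) → List A → Bool
allᵇ f [] = true
allᵇ f (x ∷ xs) = f x ∧ allᵇ f xs

eqMaybeFin : ∀ {n} → Maybe (Fin n) → Maybe (Fin n) → Bool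
eqMaybeFin nothing nothing = true
eqMaybeFin (just a) (just b) = ⌊ a ≟ b ⌋
eqMaybeFin _ _ = false

-- O_MVP(p) = π : p ∈ MVP_n and spot s is finally occupied by car π(s), for all s
hasOutcome : ∀ {n} → Pref n → Permutation′ n → Bool
hasOutcome {n} p π with mvpFinal p
... | nothing = false
... | just o = allᵇ (λ s → eqMaybeFin (o s) (just (π ⟨$⟩ʳ s))) (allFin n)

allVecs : ∀ {A : Set} → List A → (k : ℕ) → List (Vec A k)
allVecs xs zero = [] ∷ []
allVecs xs (suc k) = concatMap (λ x → map (x ∷_) (allVecs xs k)) xs

allPrefs : (n : ℕ) → List (Pref n)
allPrefs n = allVecs (allFin n) n

outcomeFiberSize : ∀ {n} → Permutation′ n → ℕ
outcomeFiberSize {n} π =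
  length (filterᵇ (λ p → isMVP p ∧ hasOutcome p π) (allPrefs n))

isInv : ∀ {n} → Permutation′ n → Fin n → Fin n → Bool
isInv π j i = (toℕ j <ᵇ toℕ i) ∧ (toℕ (π ⟨$⟩ʳ i) <ᵇ toℕ (π ⟨$⟩ʳ j))

lInvSize : ∀ {n} → Permutation′ n → Fin n → ℕ
lInvSize {n} π i = length (filterᵇ (λ j → isInv π j i) (allFin n))

-- A subset S ⊆ Inv(π) in which every i has at most one j with (j,i) ∈ S is
-- encoded (bijectively) by the vector  S : position i ↦ nothing  (no pair (·,i))
-- or  just j  (the unique pair (j,i) ∈ S).
SubCode : ℕ → Set
SubCode n = Vec (Maybe (Fin n)) n

isSub : ∀ {n} → Permutation′ n → SubCode n → Bool
isSub {n} π S = allᵇ ok (allFin n)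
  where
  ok : Fin n → Bool
  ok i with lookup S i
  ... | nothing = true
  ... | just j = isInv π j i

allMaybeFin : (n : ℕ) → List (Maybe (Fin n))
allMaybeFin n = nothing ∷ map just (allFin n)

allSubCodes : (n : ℕ) → List (SubCode n)
allSubCodes n = allVecs (allMaybeFin n) n

-- Ψ_{Sub→PF}(S): p_{π_i} = i if no (j,i) ∈ S, and p_{π_i} = j if (j,i) ∈ S.
-- As a function of the car c = π_i, i.e. i = π⁻¹(c).
psi : ∀ {n} → Permutation′ n → SubCode n → Pref n
psi {n} π S = Data.Vec.tabulate pc
  where
  pc : Fin n → Fin n
  pc c with lookup S (π ⟨$⟩ˡ c)
  ... | nothing = π ⟨$⟩ˡ c
  ... | just j = j

isValid : ∀ {n} → Permutation′ n → SubCode n → Bool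
isValid π S = hasOutcome (psi π S) π

subSize : ∀ {n} → Permutation′ n → ℕ
subSize {n} π = length (filterᵇ (isSub π) (allSubCodes n))

validSize : ∀ {n} → Permutation′ n → ℕ
validSize {n} π = length (filterᵇ (λ S → isSub π S ∧ isValid π S) (allSubCodes n))

{-# OPTIONS --safe #-}
-- In the MVP process a car is only ever bumped by a later car, and a bumped car moves to a later
-- spot.  Hence if p has outcome π, every car c either ends in its preferred spot p_c or ends in a
-- spot after p_c while p_c is held by a later car; in the latter case (p_c, π⁻¹ c) is an inversion
-- of π.  Recording, for each position i, the preferred spot of the car π_i (or nothing when it is
-- i itself) therefore maps O⁻¹(π) injectively into Sub(π); Ψ inverts it, so its image is Valid(π).
-- Finally Sub(π) is a product: position i independently picks nothing or one of its left inversions.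
module Submission where

open import Defs
open import Data.Nat using (ℕ; zero; suc; _+_; _*_; _≤_; _<ᵇ_)
open import Data.Nat.Properties using (<ᵇ⇒<; <⇒<ᵇ)
open import Data.Nat.ListAction using (product)
open import Data.Bool using (Bool; true; false; T; _∧_)
open import Data.Bool.Properties using (T-∧)
open import Data.Unit using (tt)
open import Data.Maybe using (Maybe; just; nothing; fromMaybe)
open import Data.Maybe.Properties using (just-injective)
open import Data.Fin as Fin using (Fin; zero; suc; toℕ; _≟_; _<_)
open import Data.Fin.Properties using (<-trans; <⇒≢)
open import Data.Fin.Permutation using (Permutation′; _⟨$⟩ʳ_; _⟨$⟩ˡ_; inverseʳ; inverseˡ)
open import Data.List as List using (List; []; _∷_; _++_; length; map; concatMap; filterᵇ; allFin)
open import Data.List.Properties using (map-cong; length-map; length-++; filter-++; map-tabulate; map-∘)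
open import Data.List.Relation.Unary.All as All using (All; []; _∷_)
import Data.List.Relation.Unary.All.Properties as All
open import Data.List.Relation.Unary.Any using (here; there)
import Data.List.Relation.Unary.Any as Any
open import Data.List.Relation.Unary.AllPairs as AllPairs using (AllPairs; []; _∷_)
import Data.List.Relation.Unary.AllPairs.Properties as AllPairs
open import Data.List.Relation.Unary.Unique.Propositional using (Unique)
import Data.List.Relation.Unary.Unique.Propositional.Properties as Unique
open import Data.List.Membership.Propositional using (_∈_)
open import Data.List.Relation.Binary.Disjoint.Propositional using (Disjoint)
open import Data.List.Membership.Propositional.Properties
  using (∈-map⁺; ∈-map⁻; ∈-concatMap⁺; ∈-filter⁺; ∈-filter⁻; ∈-allFin)
open import Data.List.Membership.Propositional.Properties.WithK using (unique∧set⇒bag)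
open import Data.List.Relation.Binary.BagAndSetEquality using (∼bag⇒↭)
open import Data.List.Relation.Binary.Permutation.Propositional.Properties using (↭-length)
open import Data.List.Relation.Binary.Sublist.Propositional.Properties
  using (length-mono-≤) renaming (filter⁺ to filter-⊆⁺)
open import Data.List.Relation.Binary.Sublist.Propositional using (⊆-refl)
open import Data.Vec using (Vec; lookup; tabulate) renaming ([] to []ᵥ; _∷_ to _∷ᵥ_)
open import Data.Vec.Properties using (∷-injectiveˡ; ∷-injectiveʳ; lookup∘tabulate; tabulate∘lookup; tabulate-cong)
open import Data.Product using (_×_; _,_; proj₁; proj₂; ∃-syntax)
open import Data.Sum using (_⊎_; inj₁; inj₂)
import Data.Sum as Sum
import Data.Product as Product
open import Function using (_∘_; id)
open import Function.Bundles using (mk⇔; Equivalence)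
open import Relation.Nullary using (yes; no; contradiction)
open import Relation.Nullary.Decidable using (T?)
open import Relation.Binary.PropositionalEquality

-- Counting over finite enumerations

count : {A : Set} → (A → Bool) → List A → ℕ
count f xs = length (filterᵇ f xs)

module _ {A : Set} where

  count-cong : {f g : A → Bool} → (∀ x → f x ≡ g x) → ∀ xs → count f xs ≡ count g xs
  count-cong e [] = refl
  count-cong {f} {g} e (x ∷ xs) with f x | g x | e x
  ... | true | .true | refl = cong suc (count-cong e xs)
  ... | false | .false | refl = count-cong e xs

  count-++ : (f : A → Bool) → ∀ xs ys → count f (xs ++ ys) ≡ count f xs + count f ys
  count-++ f xs ys = trans (cong length (filter-++ (T? ∘ f) xs ys)) (length-++ (filterᵇ f xs))

  count-mono : {f g : A → Bool} → (∀ {x} → T (f x) → T (g x)) → ∀ xs → count f xs ≤ count g xs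
  count-mono {f} {g} f⇒g xs = length-mono-≤ (filter-⊆⁺ (T? ∘ f) (T? ∘ g) (λ { refl → f⇒g }) (⊆-refl {x = xs}))

count-map : {A B : Set} (f : B → Bool) (h : A → B) → ∀ xs → count f (map h xs) ≡ count (f ∘ h) xs
count-map f h [] = refl
count-map f h (x ∷ xs) with f (h x)
... | true = cong suc (count-map f h xs)
... | false = count-map f h xs

count-none : {A : Set} → ∀ (xs : List A) → count (λ _ → false) xs ≡ 0
count-none [] = refl
count-none (x ∷ xs) = count-none xs

count-pairs : {A B C : Set} (g : A → B → C) (P : C → Bool) (a : A → Bool) (b : B → Bool) →
  (∀ x y → P (g x y) ≡ a x ∧ b y) →
  ∀ xs ys → count P (concatMap (λ x → map (g x) ys) xs) ≡ count a xs * count b ys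
count-pairs g P a b split [] ys = refl
count-pairs g P a b split (x ∷ xs) ys = begin
    count P (map (g x) ys ++ concatMap (λ x → map (g x) ys) xs)
  ≡⟨ count-++ P (map (g x) ys) _ ⟩
    count P (map (g x) ys) + count P (concatMap (λ x → map (g x) ys) xs)
  ≡⟨ cong₂ _+_ (trans (count-map P (g x) ys) (count-cong (split x) ys)) (count-pairs g P a b split xs ys) ⟩
    count (λ y → a x ∧ b y) ys + count a xs * count b ys
  ≡⟨ first-row ⟩
    count a (x ∷ xs) * count b ys
  ∎
  where
  open ≡-Reasoning
  first-row : count (λ y → a x ∧ b y) ys + count a xs * count b ys ≡ count a (x ∷ xs) * count b ys
  first-row with a x
  ... | true = refl
  ... | false = cong (_+ count a xs * count b ys) (count-none ys)

module _ {A : Set} where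

  allᵇ-cong : {f g : A → Bool} → (∀ x → f x ≡ g x) → ∀ xs → allᵇ f xs ≡ allᵇ g xs
  allᵇ-cong e [] = refl
  allᵇ-cong e (x ∷ xs) = cong₂ _∧_ (e x) (allᵇ-cong e xs)

  allᵇ-elim : {g : A → Bool} → ∀ xs → T (allᵇ g xs) → ∀ {x} → x ∈ xs → T (g x)
  allᵇ-elim (y ∷ xs) h (here refl) = proj₁ (Equivalence.to T-∧ h)
  allᵇ-elim (y ∷ xs) h (there x∈xs) = allᵇ-elim xs (proj₂ (Equivalence.to T-∧ h)) x∈xs

  allᵇ-intro : {g : A → Bool} → (∀ x → T (g x)) → ∀ xs → T (allᵇ g xs)
  allᵇ-intro h [] = tt
  allᵇ-intro h (x ∷ xs) = Equivalence.from T-∧ (h x , allᵇ-intro h xs)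

allᵇ-map : {A B : Set} (g : B → Bool) (f : A → B) → ∀ xs → allᵇ g (map f xs) ≡ allᵇ (g ∘ f) xs
allᵇ-map g f [] = refl
allᵇ-map g f (x ∷ xs) = cong (g (f x) ∧_) (allᵇ-map g f xs)

tabulate-suc : ∀ k → List.tabulate {n = k} Fin.suc ≡ map Fin.suc (allFin k)
tabulate-suc k = sym (map-tabulate id Fin.suc)

allᵇ-allFin-suc : ∀ {k} (g : Fin (suc k) → Bool) → allᵇ g (allFin (suc k)) ≡ g zero ∧ allᵇ (g ∘ suc) (allFin k)
allᵇ-allFin-suc {k} g = cong (g zero ∧_) (trans (cong (allᵇ g) (tabulate-suc k)) (allᵇ-map g Fin.suc (allFin k)))

product-allFin-suc : ∀ {k} (F : Fin (suc k) → ℕ) →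
  product (map F (allFin (suc k))) ≡ F zero * product (map (F ∘ suc) (allFin k))
product-allFin-suc {k} F =
  cong (λ is → F zero * product is) (trans (cong (map F) (tabulate-suc k)) (sym (map-∘ (allFin k))))

pointwiseᵇ : {A : Set} {k : ℕ} → (Fin k → A → Bool) → Vec A k → Bool
pointwiseᵇ {k = k} q v = allᵇ (λ i → q i (lookup v i)) (allFin k)

pointwiseᵇ-∷ : {A : Set} {k : ℕ} (q : Fin (suc k) → A → Bool) →
  ∀ x v → pointwiseᵇ q (x ∷ᵥ v) ≡ q zero x ∧ pointwiseᵇ (q ∘ suc) v
pointwiseᵇ-∷ q x v = allᵇ-allFin-suc (λ i → q i (lookup (x ∷ᵥ v) i))

count-pointwise-allVecs : {A : Set} (xs : List A) → ∀ k (q : Fin k → A → Bool) →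
  count (pointwiseᵇ q) (allVecs xs k) ≡ product (map (λ i → count (q i) xs) (allFin k))
count-pointwise-allVecs xs zero q = refl
count-pointwise-allVecs xs (suc k) q = begin
    count (pointwiseᵇ q) (allVecs xs (suc k))
  ≡⟨ count-pairs _∷ᵥ_ (pointwiseᵇ q) (q zero) (pointwiseᵇ (q ∘ suc)) (pointwiseᵇ-∷ q) xs (allVecs xs k) ⟩
    count (q zero) xs * count (pointwiseᵇ (q ∘ suc)) (allVecs xs k)
  ≡⟨ cong (count (q zero) xs *_) (count-pointwise-allVecs xs k (q ∘ suc)) ⟩
    count (q zero) xs * product (map (λ i → count (q (suc i)) xs) (allFin k))
  ≡⟨ sym (product-allFin-suc (λ i → count (q i) xs)) ⟩
    product (map (λ i → count (q i) xs) (allFin (suc k)))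
  ∎
  where open ≡-Reasoning

module _ {A : Set} {xs : List A} where

  ∈-allVecs : (∀ x → x ∈ xs) → ∀ {k} (v : Vec A k) → v ∈ allVecs xs k
  ∈-allVecs complete []ᵥ = here refl
  ∈-allVecs complete {suc k} (x ∷ᵥ v) =
    ∈-concatMap⁺ (λ y → map (y ∷ᵥ_) (allVecs xs k))
      (Any.map (λ { refl → ∈-map⁺ (x ∷ᵥ_) (∈-allVecs complete v) }) (complete x))

  allVecs-unique : Unique xs → ∀ k → Unique (allVecs xs k)
  allVecs-unique unique zero = [] ∷ []
  allVecs-unique unique (suc k) =
    Unique.concat⁺ (All.map⁺ (All.universal (λ x → Unique.map⁺ ∷-injectiveʳ (allVecs-unique unique k)) xs))
                   (AllPairs.map⁺ (AllPairs.map disjoint unique))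
    where
    disjoint : ∀ {x y} → x ≢ y → Disjoint (map (x ∷ᵥ_) (allVecs xs k)) (map (y ∷ᵥ_) (allVecs xs k))
    disjoint x≢y (v∈x , v∈y) with _ , _ , refl ← ∈-map⁻ _ v∈x | _ , _ , eq ← ∈-map⁻ _ v∈y =
      x≢y (∷-injectiveˡ eq)

∈-allMaybeFin : ∀ {n} (m : Maybe (Fin n)) → m ∈ allMaybeFin n
∈-allMaybeFin nothing = here refl
∈-allMaybeFin (just i) = there (∈-map⁺ just (∈-allFin i))

allMaybeFin-unique : ∀ n → Unique (allMaybeFin n)
allMaybeFin-unique n = All.map⁺ (All.universal (λ _ ()) (allFin n)) ∷ Unique.map⁺ just-injective (Unique.allFin⁺ n)

∈-allPrefs : ∀ {n} (p : Pref n) → p ∈ allPrefs n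
∈-allPrefs = ∈-allVecs ∈-allFin

∈-allSubCodes : ∀ {n} (S : SubCode n) → S ∈ allSubCodes n
∈-allSubCodes = ∈-allVecs ∈-allMaybeFin

module _ {A B : Set} {P : A → Bool} {Q : B → Bool} {xs : List A} {ys : List B}
         (xs-unique : Unique xs) (ys-unique : Unique ys)
         (xs-complete : ∀ a → a ∈ xs) (ys-complete : ∀ b → b ∈ ys)
         (to : A → B) (from : B → A) where

  count-bijection : (∀ a → from (to a) ≡ a) → (∀ {b} → T (Q b) → to (from b) ≡ b) →
    (∀ {a} → T (P a) → T (Q (to a))) → (∀ {b} → T (Q b) → T (P (from b))) →
    count P xs ≡ count Q ys
  count-bijection from∘to to∘from P⇒Q Q⇒P = begin
      count P xs
    ≡⟨ length-map to (filterᵇ P xs) ⟨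
      length (map to (filterᵇ P xs))
    ≡⟨ ↭-length (∼bag⇒↭ (unique∧set⇒bag image-unique (Unique.filter⁺ (T? ∘ Q) ys-unique) (mk⇔ image⊆ ⊆image))) ⟩
      count Q ys
    ∎
    where
    open ≡-Reasoning
    image-unique : Unique (map to (filterᵇ P xs))
    image-unique = Unique.map⁺ (λ {a} {a′} eq → trans (sym (from∘to a)) (trans (cong from eq) (from∘to a′)))
                               (Unique.filter⁺ (T? ∘ P) xs-unique)
    image⊆ : ∀ {b} → b ∈ map to (filterᵇ P xs) → b ∈ filterᵇ Q ys
    image⊆ b∈ with a , a∈ , refl ← ∈-map⁻ to b∈ =
      ∈-filter⁺ (T? ∘ Q) (ys-complete (to a)) (P⇒Q (proj₂ (∈-filter⁻ (T? ∘ P) {xs = xs} a∈)))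
    ⊆image : ∀ {b} → b ∈ filterᵇ Q ys → b ∈ map to (filterᵇ P xs)
    ⊆image {b} b∈ = subst (_∈ map to (filterᵇ P xs)) (to∘from Qb)
                      (∈-map⁺ to (∈-filter⁺ (T? ∘ P) (xs-complete (from b)) (Q⇒P Qb)))
      where
      Qb : T (Q b)
      Qb = proj₂ (∈-filter⁻ (T? ∘ Q) {xs = ys} b∈)

-- The inversion subsets Sub(π)

isSubEntry : ∀ {n} → Permutation′ n → Fin n → Maybe (Fin n) → Bool
isSubEntry π i nothing = true
isSubEntry π i (just j) = isInv π j i

mutual
  isSub-pointwise : ∀ {n} (π : Permutation′ n) S → isSub π S ≡ pointwiseᵇ (isSubEntry π) S
  isSub-pointwise {n} π S = allᵇ-cong (isSub-entry π S) (allFin n)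

  -- The left-hand side is the anonymous local test inside isSub; the use above determines it.
  isSub-entry : ∀ {n} (π : Permutation′ n) S i → _ ≡ isSubEntry π i (lookup S i)
  isSub-entry π S i with lookup S i
  ... | nothing = refl
  ... | just j = refl

subSize≡product : ∀ {n} (π : Permutation′ n) → subSize π ≡ product (map (λ i → suc (lInvSize π i)) (allFin n))
subSize≡product {n} π = begin
    subSize π
  ≡⟨ count-cong (isSub-pointwise π) (allSubCodes n) ⟩
    count (pointwiseᵇ (isSubEntry π)) (allSubCodes n)
  ≡⟨ count-pointwise-allVecs (allMaybeFin n) n (isSubEntry π) ⟩
    product (map (λ i → count (isSubEntry π i) (allMaybeFin n)) (allFin n))
  ≡⟨ cong product (map-cong (λ i → cong suc (count-map (isSubEntry π i) just (allFin n))) (allFin n)) ⟩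
    product (map (λ i → suc (lInvSize π i)) (allFin n))
  ∎
  where open ≡-Reasoning

validSize≤subSize : ∀ {n} (π : Permutation′ n) → validSize π ≤ subSize π
validSize≤subSize {n} π = count-mono (proj₁ ∘ Equivalence.to T-∧) (allSubCodes n)

-- The MVP process

module _ {n : ℕ} where

  update-≡ : (o : Occ n) (s : Fin n) (v : Maybe (Fin n)) → update o s v s ≡ v
  update-≡ o s v with s ≟ s
  ... | yes _ = refl
  ... | no s≢s = contradiction refl s≢s

  update-≢ : (o : Occ n) {s t : Fin n} (v : Maybe (Fin n)) → t ≢ s → update o s v t ≡ o t
  update-≢ o {s} {t} v t≢s with t ≟ s
  ... | yes t≡s = contradiction t≡s t≢s
  ... | no _ = refl

  mutual
    firstFreeAfter-spec : (o : Occ n) (s : Fin n) {k : Fin n} → firstFreeAfter o s ≡ just k → s < k × o k ≡ nothing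
    firstFreeAfter-spec o s found with allFin n
    ... | ks = firstFreeIn-spec o s ks found

    -- The left-hand side is the anonymous local search inside firstFreeAfter; the use above determines it.
    firstFreeIn-spec : (o : Occ n) (s : Fin n) (ks : List (Fin n)) {k : Fin n} → _ ≡ just k → s < k × o k ≡ nothing
    firstFreeIn-spec o s [] ()
    firstFreeIn-spec o s (k′ ∷ ks) found with toℕ s <ᵇ toℕ k′ in s<k′ | o k′ in free
    ... | true | nothing with refl ← found = <ᵇ⇒< _ _ (subst T (sym s<k′) tt) , free
    ... | true | just _ = firstFreeIn-spec o s ks found
    ... | false | _ = firstFreeIn-spec o s ks found

  data Placement (o : Occ n) (i s f c : Fin n) : Set where
    arrived : f ≡ s → c ≡ i → Placement o i s f c
    unmoved : o f ≡ just c → Placement o i s f c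
    bumped  : o s ≡ just c → s < f → Placement o i s f c

  record StepEffect (o : Occ n) (i s : Fin n) (o′ : Occ n) : Set where
    field
      arrives : o′ s ≡ just i
      stays   : ∀ {t d} → t ≢ s → o t ≡ just d → o′ t ≡ just d
      source  : ∀ {f c} → o′ f ≡ just c → Placement o i s f c

  free-step : {o : Occ n} {i s : Fin n} → o s ≡ nothing → StepEffect o i s (update o s (just i))
  free-step {o} {i} {s} free = record
    { arrives = update-≡ o s (just i)
    ; stays   = λ t≢s otd → trans (update-≢ o (just i) t≢s) otd
    ; source  = placement
    }
    where
    placement : ∀ {f c} → update o s (just i) f ≡ just c → Placement o i s f c
    placement {f} o′f with f ≟ s
    ... | yes f≡s = arrived f≡s (just-injective (sym o′f))
    ... | no _ = unmoved o′f

  bump-step : {o : Occ n} {i s j k : Fin n} → o s ≡ just j → s < k → o k ≡ nothing →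
    StepEffect o i s (update (update o s (just i)) k (just j))
  bump-step {o} {i} {s} {j} {k} occupied s<k free = record
    { arrives = trans (update-≢ o₁ (just j) (<⇒≢ s<k)) (update-≡ o s (just i))
    ; stays   = λ t≢s otd → trans (update-≢ o₁ (just j) (λ { refl → contradiction (trans (sym otd) free) λ () }))
                                  (trans (update-≢ o (just i) t≢s) otd)
    ; source  = placement
    }
    where
    o₁ : Occ n
    o₁ = update o s (just i)
    placement : ∀ {f c} → update o₁ k (just j) f ≡ just c → Placement o i s f c
    placement {f} o′f with f ≟ k
    ... | yes refl = bumped (trans occupied o′f) s<k
    ... | no _ with f ≟ s
    ...   | yes f≡s = arrived f≡s (just-injective (sym o′f))
    ...   | no _ = unmoved o′f

  mvpStep-effect : {o o′ : Occ n} {i s : Fin n} → mvpStep o i s ≡ just o′ → StepEffect o i s o′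
  mvpStep-effect {o} {s = s} step with o s in occupant
  ... | nothing with refl ← step = free-step occupant
  ... | just j with firstFreeAfter o s in found
  ...   | just k with refl ← step = Product.uncurry (bump-step occupant) (firstFreeAfter-spec o s found)
  ...   | nothing with () ← step

module _ {n : ℕ} where

  open StepEffect

  OccupiedByLater : Occ n → Fin n → Fin n → Set
  OccupiedByLater o t c = ∃[ d ] o t ≡ just d × c < d

  -- A car away from its preferred spot was bumped from it, and occupants are only ever replaced by later cars.
  Settled : Pref n → Occ n → Set
  Settled p o = ∀ {f c} → o f ≡ just c →
    lookup p c ≡ f ⊎ (lookup p c < f × OccupiedByLater o (lookup p c) c)

  ParkedBefore : Occ n → Fin n → Set
  ParkedBefore o i = ∀ {f c} → o f ≡ just c → c < i

  occupiedByLater-step : {o o′ : Occ n} {i s t c : Fin n} → StepEffect o i s o′ → ParkedBefore o i →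
    OccupiedByLater o t c → OccupiedByLater o′ t c
  occupiedByLater-step {i = i} {s} {t} effect before (d , otd , c<d) with t ≟ s
  ... | yes refl = i , arrives effect , <-trans c<d (before otd)
  ... | no t≢s = d , stays effect t≢s otd , c<d

  settled-step : {p : Pref n} {o o′ : Occ n} {i : Fin n} → StepEffect o i (lookup p i) o′ → ParkedBefore o i →
    Settled p o → Settled p o′
  settled-step {p} {i = i} effect before settled o′f with source effect o′f
  ... | arrived refl refl = inj₁ refl
  ... | unmoved of = Sum.map₂ (Product.map₂ (occupiedByLater-step effect before)) (settled of)
  ... | bumped os s<f with settled os
  ...   | inj₁ pc≡s rewrite pc≡s = inj₂ (s<f , i , arrives effect , before os)
  ...   | inj₂ (pc<s , later) = inj₂ (<-trans pc<s s<f , occupiedByLater-step effect before later)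

  settled-run : {p : Pref n} {o o′ : Occ n} {is : List (Fin n)} → AllPairs _<_ is →
    (∀ {f c} → o f ≡ just c → All (c <_) is) → Settled p o → mvpRun p is o ≡ just o′ → Settled p o′
  settled-run [] before settled refl = settled
  settled-run {p} {o} {is = i ∷ is} (i<is ∷ sorted) before settled run with mvpStep o i (lookup p i) in step
  ... | just o₁ = settled-run sorted before₁ (settled-step {p} effect (All.head ∘ before) settled) run
    where
    effect : StepEffect o i (lookup p i) o₁
    effect = mvpStep-effect step
    before₁ : ∀ {f c} → o₁ f ≡ just c → All (c <_) is
    before₁ o₁f with source effect o₁f
    ... | arrived _ refl = i<is
    ... | unmoved of = All.tail (before of)
    ... | bumped os _ = All.tail (before os)
  ... | nothing with () ← run

  settled-final : {p : Pref n} {o : Occ n} → mvpFinal p ≡ just o → Settled p o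
  settled-final = settled-run (AllPairs.tabulate⁺-< id) (λ ()) (λ ())

module _ {n : ℕ} {π : Permutation′ n} where

  isInv-intro : {j i : Fin n} → j < i → π ⟨$⟩ʳ i < π ⟨$⟩ʳ j → T (isInv π j i)
  isInv-intro j<i πi<πj = Equivalence.from T-∧ (<⇒<ᵇ j<i , <⇒<ᵇ πi<πj)

  isInv⇒< : {j i : Fin n} → T (isInv π j i) → j < i
  isInv⇒< inv = <ᵇ⇒< _ _ (proj₁ (Equivalence.to T-∧ inv))

  eqMaybeFin-sound : {a b : Maybe (Fin n)} → T (eqMaybeFin a b) → a ≡ b
  eqMaybeFin-sound {nothing} {nothing} _ = refl
  eqMaybeFin-sound {just a} {just b} eq with a ≟ b
  ... | yes refl = refl

  hasOutcome⇒isMVP : {p : Pref n} → T (hasOutcome p π) → T (isMVP p)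
  hasOutcome⇒isMVP {p} h with mvpFinal p
  ... | just _ = tt

  hasOutcome-final : {p : Pref n} → T (hasOutcome p π) → ∃[ o ] mvpFinal p ≡ just o × (∀ s → o s ≡ just (π ⟨$⟩ʳ s))
  hasOutcome-final {p} h with mvpFinal p
  ... | just o = o , refl , λ s → eqMaybeFin-sound (allᵇ-elim (allFin n) h (∈-allFin s))

  preferred-or-inversion : {p : Pref n} → T (hasOutcome p π) → ∀ c →
    lookup p c ≡ π ⟨$⟩ˡ c ⊎ T (isInv π (lookup p c) (π ⟨$⟩ˡ c))
  preferred-or-inversion h c with o , final , occupant ← hasOutcome-final h
    with settled-final final (trans (occupant (π ⟨$⟩ˡ c)) (cong just (inverseʳ π)))
  ... | inj₁ preferred = inj₁ preferred
  ... | inj₂ (p<f , d , od , c<d) =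
    inj₂ (isInv-intro p<f (subst₂ _<_ (sym (inverseʳ π)) (just-injective (trans (sym od) (occupant _))) c<d))

-- Ψ and its inverse

lookup-ext : {A : Set} {n : ℕ} {u v : Vec A n} → (∀ i → lookup u i ≡ lookup v i) → u ≡ v
lookup-ext {u = u} {v} eq = trans (sym (tabulate∘lookup u)) (trans (tabulate-cong eq) (tabulate∘lookup v))

module _ {n : ℕ} (π : Permutation′ n) where

  preferenceEntry : Fin n → Fin n → Maybe (Fin n)
  preferenceEntry a i with a ≟ i
  ... | yes _ = nothing
  ... | no _ = just a

  psi⁻¹ : Pref n → SubCode n
  psi⁻¹ p = tabulate λ i → preferenceEntry (lookup p (π ⟨$⟩ʳ i)) i

  fromMaybe-preferenceEntry : ∀ a i → fromMaybe i (preferenceEntry a i) ≡ a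
  fromMaybe-preferenceEntry a i with a ≟ i
  ... | yes refl = refl
  ... | no _ = refl

  preferenceEntry-fromMaybe : ∀ i {m} → T (isSubEntry π i m) → preferenceEntry (fromMaybe i m) i ≡ m
  preferenceEntry-fromMaybe i {nothing} _ with i ≟ i
  ... | yes _ = refl
  ... | no i≢i = contradiction refl i≢i
  preferenceEntry-fromMaybe i {just j} inv with j ≟ i
  ... | yes refl = contradiction refl (<⇒≢ (isInv⇒< {π = π} inv))
  ... | no _ = refl

  isSubEntry-preferenceEntry : ∀ {a i} → a ≡ i ⊎ T (isInv π a i) → T (isSubEntry π i (preferenceEntry a i))
  isSubEntry-preferenceEntry {a} {i} preferred-or-inversion with a ≟ i | preferred-or-inversion
  ... | yes _ | _ = tt
  ... | no a≢i | inj₁ a≡i = contradiction a≡i a≢i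
  ... | no _ | inj₂ inv = inv

  mutual
    psi-lookup : ∀ S c → lookup (psi π S) c ≡ fromMaybe (π ⟨$⟩ˡ c) (lookup S (π ⟨$⟩ˡ c))
    psi-lookup S c = trans (lookup∘tabulate _ c) (psi-entry S c)

    -- The left-hand side is the anonymous local function inside psi; the use above determines it.
    psi-entry : ∀ S c → _ ≡ fromMaybe (π ⟨$⟩ˡ c) (lookup S (π ⟨$⟩ˡ c))
    psi-entry S c with lookup S (π ⟨$⟩ˡ c)
    ... | nothing = refl
    ... | just j = refl

  psi-psi⁻¹ : ∀ p → psi π (psi⁻¹ p) ≡ p
  psi-psi⁻¹ p = lookup-ext λ c → begin
      lookup (psi π (psi⁻¹ p)) c
    ≡⟨ psi-lookup (psi⁻¹ p) c ⟩
      fromMaybe (π ⟨$⟩ˡ c) (lookup (psi⁻¹ p) (π ⟨$⟩ˡ c))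
    ≡⟨ cong (fromMaybe (π ⟨$⟩ˡ c)) (lookup∘tabulate _ (π ⟨$⟩ˡ c)) ⟩
      fromMaybe (π ⟨$⟩ˡ c) (preferenceEntry (lookup p (π ⟨$⟩ʳ (π ⟨$⟩ˡ c))) (π ⟨$⟩ˡ c))
    ≡⟨ fromMaybe-preferenceEntry _ (π ⟨$⟩ˡ c) ⟩
      lookup p (π ⟨$⟩ʳ (π ⟨$⟩ˡ c))
    ≡⟨ cong (lookup p) (inverseʳ π) ⟩
      lookup p c
    ∎
    where open ≡-Reasoning

  isSub-entries : ∀ {S} → T (isSub π S) → ∀ i → T (isSubEntry π i (lookup S i))
  isSub-entries {S} sub i = allᵇ-elim (allFin n) (subst T (isSub-pointwise π S) sub) (∈-allFin i)

  psi⁻¹-psi : ∀ {S} → T (isSub π S) → psi⁻¹ (psi π S) ≡ S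
  psi⁻¹-psi {S} sub = lookup-ext λ i → begin
      lookup (psi⁻¹ (psi π S)) i
    ≡⟨ lookup∘tabulate _ i ⟩
      preferenceEntry (lookup (psi π S) (π ⟨$⟩ʳ i)) i
    ≡⟨ cong (λ a → preferenceEntry a i) (psi-lookup S (π ⟨$⟩ʳ i)) ⟩
      preferenceEntry (fromMaybe (π ⟨$⟩ˡ (π ⟨$⟩ʳ i)) (lookup S (π ⟨$⟩ˡ (π ⟨$⟩ʳ i)))) i
    ≡⟨ cong (λ j → preferenceEntry (fromMaybe j (lookup S j)) i) (inverseˡ π) ⟩
      preferenceEntry (fromMaybe i (lookup S i)) i
    ≡⟨ preferenceEntry-fromMaybe i (isSub-entries {S} sub i) ⟩
      lookup S i
    ∎
    where open ≡-Reasoning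

  isSub-psi⁻¹ : ∀ {p} → T (hasOutcome p π) → T (isSub π (psi⁻¹ p))
  isSub-psi⁻¹ {p} outcome = subst T (sym (isSub-pointwise π (psi⁻¹ p))) (allᵇ-intro entry (allFin n))
    where
    entry : ∀ i → T (isSubEntry π i (lookup (psi⁻¹ p) i))
    entry i rewrite lookup∘tabulate (λ i → preferenceEntry (lookup p (π ⟨$⟩ʳ i)) i) i =
      isSubEntry-preferenceEntry
        (subst (λ j → lookup p (π ⟨$⟩ʳ i) ≡ j ⊎ T (isInv π (lookup p (π ⟨$⟩ʳ i)) j)) (inverseˡ π)
               (preferred-or-inversion outcome (π ⟨$⟩ʳ i)))

outcomeFiberSize≡validSize : ∀ {n} (π : Permutation′ n) → outcomeFiberSize π ≡ validSize π
outcomeFiberSize≡validSize {n} π =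
  count-bijection (allVecs-unique (Unique.allFin⁺ n) n) (allVecs-unique (allMaybeFin-unique n) n)
    ∈-allPrefs ∈-allSubCodes (psi⁻¹ π) (psi π) (psi-psi⁻¹ π)
    (λ {S} valid → psi⁻¹-psi π (proj₁ (Equivalence.to (T-∧ {isSub π S}) valid)))
    (λ {p} → fiber⇒valid {p}) (λ {S} → valid⇒fiber {S})
  where
  fiber⇒valid : ∀ {p} → T (isMVP p ∧ hasOutcome p π) → T (isSub π (psi⁻¹ π p) ∧ isValid π (psi⁻¹ π p))
  fiber⇒valid {p} fiber = Equivalence.from (T-∧ {isSub π (psi⁻¹ π p)})
    (isSub-psi⁻¹ π outcome , subst (λ q → T (hasOutcome q π)) (sym (psi-psi⁻¹ π p)) outcome)
    where
    outcome : T (hasOutcome p π)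
    outcome = proj₂ (Equivalence.to (T-∧ {isMVP p}) fiber)

  valid⇒fiber : ∀ {S} → T (isSub π S ∧ isValid π S) → T (isMVP (psi π S) ∧ hasOutcome (psi π S) π)
  valid⇒fiber {S} valid = Equivalence.from (T-∧ {isMVP (psi π S)}) (hasOutcome⇒isMVP outcome , outcome)
    where
    outcome : T (hasOutcome (psi π S) π)
    outcome = proj₂ (Equivalence.to (T-∧ {isSub π S}) valid)

corollary2p7 : (n : ℕ) (π : Permutation′ n) →
    (outcomeFiberSize π ≡ validSize π)
    × (validSize π ≤ subSize π)
    × (subSize π ≡ product (map (λ i → suc (lInvSize π i)) (allFin n)))
corollary2p7 n π = outcomeFiberSize≡validSize π , validSize≤subSize π , subSize≡product π
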